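{- For every $N\ge1$, the PASEP partition function $Z_N(\alpha,\beta,y,q)$ specialized at $\frac1\alpha=-y$, $\beta=1$, $q=0$ equals $F_N(y)$; that is, $\sum_{i,j}c^{(N)}_{i,j}\big|_{q=0}\,(-y)^i=F_N(y)$.
   Context: Let $\mathcal A$ be the associative algebra over $\mathbb Z[y,q]$ generated by $D,E$ subject to $DE-qED=D+E$; every element is uniquely a finite $\mathbb Z[y,q]$-combination of words $E^iD^j$, and we write $(yD+E)^N=\sum_{i,j}c^{(N)}_{i,j}E^iD^j$. The PASEP partition function is $Z_N(\alpha,\beta,y,q)=\sum_{i,j}c^{(N)}_{i,j}\alpha^{ -i}\beta^{ -j}$. A Dyck path of length $2n$ is a path of $n$ steps $\nearrow$ and $n$ steps $\searrow$ from height 0 to height 0 never going below 0; a peak is a factor $\nearrow\searrow$, and $\mathrm{pk}(P)$ is the number of peaks of $P$. A Fine path is a Dyck path $P$ admitting no factorization $P=P_1\nearrow\searrow P_2$ with $P_1,P_2$ (possibly empty) Dyck paths. $F_n(y)=\sum_P y^{\mathrm{pk}(P)}$, the sum over Fine paths $P$ of length $2n$. -}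

module Defs where

open import Data.Nat using (ℕ; zero; suc; _+_; _≡ᵇ_)
open import Data.Integer as ℤ using (ℤ; +_; -_)
open import Data.Bool using (Bool; true; false; if_then_else_; _∧_)
open import Data.List using (List; []; _∷_; _++_; map; concatMap; filter; foldr)
open import Data.Product using (Σ; _×_; ∃)
open import Data.Empty using (⊥)
open import Relation.Binary.PropositionalEquality using (_≡_)
open import Relation.Nullary using (¬_)

-- The algebra A over ℤ[y,q] with DE - qED = D + E, in normal form.
-- An element is a formal finite sum of terms  coef · y^ye q^qe E^ei D^dj
-- (terms with equal (ye,qe,ei,dj) may repeat; they add up).

record Term : Set where
  constructor term
  field
    coef : ℤ
    ye   : ℕ
    qe   : ℕ
    ei   : ℕ
    dj   : ℕ
open Term public

Elt : Set
Elt = List Term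

Emul : Term → Term
Emul (term c a b i j) = term c a b (suc i) j

qmul : Term → Term
qmul (term c a b i j) = term c a (suc b) i j

-- normal form of D E^i, using  D E^(i+1) = (DE) E^i = (qED + D + E) E^i
--                                         = q E (D E^i) + D E^i + E^(i+1)
dE : ℕ → Elt
dE zero    = term (+ 1) 0 0 0 1 ∷ []
dE (suc i) = map (λ t → qmul (Emul t)) (dE i) ++ dE i ++ (term (+ 1) 0 0 (suc i) 0 ∷ [])

-- left multiplication by D of a normal term:  D (c y^a q^b E^i D^j) = c y^a q^b (D E^i) D^j
Dmul : Term → Elt
Dmul (term c a b i j) =
  map (λ s → term (c ℤ.* coef s) (a + ye s) (b + qe s) (ei s) (dj s + j)) (dE i)

ymul : Term → Term
ymul (term c a b i j) = term c (suc a) b i j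

mulX : Elt → Elt
mulX xs = concatMap (λ t → map ymul (Dmul t)) xs ++ map Emul xs

powX : ℕ → Elt
powX zero    = term (+ 1) 0 0 0 0 ∷ []
powX (suc n) = mulX (powX n)

-- c^{(N)}_{i,j} as a polynomial in y,q: its coefficient of y^a q^b
c : ℕ → ℕ → ℕ → ℕ → ℕ → ℤ
c N i j a b = foldr (λ t acc →
  if (ei t ≡ᵇ i) ∧ (dj t ≡ᵇ j) ∧ (ye t ≡ᵇ a) ∧ (qe t ≡ᵇ b) then coef t ℤ.+ acc else acc)
  (+ 0) (powX N)

sgn : ℕ → ℤ
sgn zero    = + 1
sgn (suc i) = - sgn i

-- Coefficient of y^k in  Σ_{i,j} c^{(N)}_{i,j}|_{q=0} (-y)^i
--   = Σ over terms with q-exponent 0 and ye + ei = k of coef · (-1)^ei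
ZspecCoeff : ℕ → ℕ → ℤ
ZspecCoeff N k = foldr (λ t acc →
  if (qe t ≡ᵇ 0) ∧ ((ye t + ei t) ≡ᵇ k) then (coef t ℤ.* sgn (ei t)) ℤ.+ acc else acc)
  (+ 0) (powX N)

data Step : Set where
  U D : Step

ValidFrom : ℕ → List Step → Set
ValidFrom h       []      = h ≡ 0
ValidFrom h       (U ∷ p) = ValidFrom (suc h) p
ValidFrom zero    (D ∷ p) = ⊥
ValidFrom (suc h) (D ∷ p) = ValidFrom h p

Dyck : List Step → Set
Dyck p = ValidFrom 0 p

pk : List Step → ℕ
pk []            = 0
pk (U ∷ D ∷ p)   = suc (pk (D ∷ p))
pk (_ ∷ p)       = pk p

Fine : List Step → Set
Fine P = Dyck P × ¬ (Σ (List Step) λ P₁ → Σ (List Step) λ P₂ →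
                       Dyck P₁ × Dyck P₂ × (P ≡ P₁ ++ U ∷ D ∷ P₂))

-- At q = 0 the relation DE = D + E gives D Eⁱ = D + E + ⋯ + Eⁱ, and the specialisation
-- ⟨W| E = −y ⟨W|, D |V⟩ = |V⟩ turns Z_N into a signed sum which obeys a simple recurrence in
-- N and the number i of pending E's. Replacing the last pending E by E + y (which ⟨W|
-- annihilates) removes the signs: the resulting numbers satisfy the same recurrence as the
-- counts of hill-free paths (no peak at height 1) by their number of peaks, read off a
-- finite automaton scanning the path from the left.
module Submission where

open import Defs
open import Data.Bool using (Bool; true; false; if_then_else_; _∧_; T)
open import Data.Empty using (⊥-elim)
open import Data.Integer as ℤ using (ℤ; +_; _+_; _-_)
import Data.Integer.Properties as ℤ
open import Data.Integer.Tactic.RingSolver using (solve-∀)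
open import Data.List using (List; []; _∷_; _++_; map; concatMap; foldr; filter; length)
open import Data.List.Properties using (∷-injectiveʳ)
open import Data.List.Membership.Propositional using (_∈_)
open import Data.List.Membership.Propositional.Properties
  using (∈-++⁻; ∈-++⁺ˡ; ∈-++⁺ʳ; ∈-map⁻; ∈-map⁺; ∈-filter⁻; ∈-filter⁺)
open import Data.List.Relation.Unary.Any using (here)
import Data.List.Relation.Unary.All as All
import Data.List.Relation.Unary.AllPairs as AllPairs
open import Data.List.Relation.Unary.Unique.Propositional using (Unique)
import Data.List.Relation.Unary.Unique.Propositional.Properties as Unique
open import Data.Nat as ℕ using (ℕ; zero; suc; _≤_; _<_; _*_; _≡ᵇ_; s≤s)
import Data.Nat.Properties as ℕ
open import Data.Product using (Σ; _×_; _,_)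
open import Data.Sum using (inj₁; inj₂)
open import Function using (_∘_)
open import Function.Bundles using (_⇔_; mk⇔; Equivalence)
open import Relation.Nullary using (¬_; yes; no)
open import Relation.Nullary.Decidable using (T?)
open import Relation.Binary.PropositionalEquality
  using (_≡_; refl; sym; trans; cong; cong₂; module ≡-Reasoning)

open ≡-Reasoning

private
  variable
    A B : Set

∑ : (A → ℤ) → List A → ℤ
∑ f = foldr (λ x s → f x + s) (+ 0)

∑-++ : ∀ (f : A → ℤ) xs ys → ∑ f (xs ++ ys) ≡ ∑ f xs + ∑ f ys
∑-++ f []       ys = sym (ℤ.+-identityˡ _)
∑-++ f (x ∷ xs) ys = trans (cong (λ s → f x + s) (∑-++ f xs ys)) (sym (ℤ.+-assoc (f x) _ _))

∑-map : ∀ (f : B → ℤ) (g : A → B) xs → ∑ f (map g xs) ≡ ∑ (f ∘ g) xs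
∑-map f g []       = refl
∑-map f g (x ∷ xs) = cong (λ s → f (g x) + s) (∑-map f g xs)

∑-concatMap : ∀ (f : B → ℤ) (g : A → List B) xs → ∑ f (concatMap g xs) ≡ ∑ (∑ f ∘ g) xs
∑-concatMap f g []       = refl
∑-concatMap f g (x ∷ xs) = trans (∑-++ f (g x) _) (cong (λ s → ∑ f (g x) + s) (∑-concatMap f g xs))

∑-cong : ∀ {f g : A → ℤ} → (∀ x → f x ≡ g x) → ∀ xs → ∑ f xs ≡ ∑ g xs
∑-cong f≗g []       = refl
∑-cong f≗g (x ∷ xs) = cong₂ _+_ (f≗g x) (∑-cong f≗g xs)

∑-zero : ∀ {f : A → ℤ} → (∀ x → f x ≡ + 0) → ∀ xs → ∑ f xs ≡ + 0
∑-zero f≗0 []       = refl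
∑-zero f≗0 (x ∷ xs) = cong₂ _+_ (f≗0 x) (∑-zero f≗0 xs)

∑-+ : ∀ (f g : A → ℤ) xs → ∑ (λ x → f x + g x) xs ≡ ∑ f xs + ∑ g xs
∑-+ f g []       = refl
∑-+ f g (x ∷ xs) = trans (cong (λ s → f x + g x + s) (∑-+ f g xs)) (interchange (f x) (g x) _ _)
  where
  interchange : ∀ a b c d → (a + b) + (c + d) ≡ (a + c) + (b + d)
  interchange = solve-∀

count : (A → Bool) → List A → ℤ
count p = ∑ (λ x → if p x then + 1 else + 0)

count-false : (xs : List A) → count (λ _ → false) xs ≡ + 0
count-false = ∑-zero (λ _ → refl)

length-filter : ∀ (p : A → Bool) xs → + length (filter (T? ∘ p) xs) ≡ count p xs
length-filter p []       = refl
length-filter p (x ∷ xs) with p x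
... | true  = trans (ℤ.pos-+ 1 _) (cong (λ s → + 1 + s) (length-filter p xs))
... | false = trans (length-filter p xs) (sym (ℤ.+-identityˡ _))

sum₁ : ℕ → (ℕ → ℤ) → ℤ
sum₁ zero    f = + 0
sum₁ (suc n) f = sum₁ n f + f (suc n)

sum₀ : ℕ → (ℕ → ℤ) → ℤ
sum₀ n f = f 0 + sum₁ n f

sum₁-cong : ∀ n {f g : ℕ → ℤ} → (∀ l → f l ≡ g l) → sum₁ n f ≡ sum₁ n g
sum₁-cong zero    f≗g = refl
sum₁-cong (suc n) f≗g = cong₂ _+_ (sum₁-cong n f≗g) (f≗g (suc n))

sum₀-cong : ∀ n {f g : ℕ → ℤ} → (∀ l → f l ≡ g l) → sum₀ n f ≡ sum₀ n g
sum₀-cong n f≗g = cong₂ _+_ (f≗g 0) (sum₁-cong n f≗g)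

sum₁-*ˡ : ∀ n c f → sum₁ n (λ l → c ℤ.* f l) ≡ c ℤ.* sum₁ n f
sum₁-*ˡ zero    c f = sym (ℤ.*-zeroʳ c)
sum₁-*ˡ (suc n) c f =
  trans (cong (_+ c ℤ.* f (suc n)) (sum₁-*ˡ n c f)) (sym (ℤ.*-distribˡ-+ c (sum₁ n f) (f (suc n))))

sum₁-suc : ∀ n f → sum₁ (suc n) f ≡ sum₀ n (f ∘ suc)
sum₁-suc zero    f = trans (ℤ.+-identityˡ (f 1)) (sym (ℤ.+-identityʳ (f 1)))
sum₁-suc (suc n) f =
  trans (cong (_+ f (suc (suc n))) (sum₁-suc n f)) (ℤ.+-assoc (f 1) (sum₁ n (f ∘ suc)) _)

sum₁-- : ∀ n f g → sum₁ n (λ l → f l - g l) ≡ sum₁ n f - sum₁ n g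
sum₁-- zero    f g = refl
sum₁-- (suc n) f g =
  trans (cong (_+ (f (suc n) - g (suc n))) (sum₁-- n f g))
        (regroup (sum₁ n f) (sum₁ n g) (f (suc n)) (g (suc n)))
  where
  regroup : ∀ a b c d → (a - b) + (c - d) ≡ (a + c) - (b + d)
  regroup = solve-∀

sum₀-- : ∀ n f g → sum₀ n (λ l → f l - g l) ≡ sum₀ n f - sum₀ n g
sum₀-- n f g =
  trans (cong (λ s → f 0 - g 0 + s) (sum₁-- n f g)) (regroup (f 0) (g 0) (sum₁ n f) (sum₁ n g))
  where
  regroup : ∀ a b c d → (a - b) + (c - d) ≡ (a + c) - (b + d)
  regroup = solve-∀

-- The specialisation at q = 0

-- At q = 0 this says D Eⁱ = D + E + ⋯ + Eⁱ.
∑-dE : ∀ i (f : Term → ℤ) → (∀ c a b l j → f (term c a (suc b) l j) ≡ + 0) →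
       ∑ f (dE i) ≡ f (term (+ 1) 0 0 0 1) + sum₁ i (λ l → f (term (+ 1) 0 0 l 0))
∑-dE zero    f f-q⁺ = refl
∑-dE (suc i) f f-q⁺ = begin
    ∑ f (map (qmul ∘ Emul) (dE i) ++ dE i ++ Eⁱ⁺¹ ∷ [])
  ≡⟨ ∑-++ f (map (qmul ∘ Emul) (dE i)) _ ⟩
    ∑ f (map (qmul ∘ Emul) (dE i)) + ∑ f (dE i ++ Eⁱ⁺¹ ∷ [])
  ≡⟨ cong₂ _+_ q-terms (∑-++ f (dE i) _) ⟩
    + 0 + (∑ f (dE i) + (f Eⁱ⁺¹ + + 0))
  ≡⟨ cong (λ s → + 0 + (s + (f Eⁱ⁺¹ + + 0))) (∑-dE i f f-q⁺) ⟩
    + 0 + ((f (term (+ 1) 0 0 0 1) + sum₁ i (λ l → f (term (+ 1) 0 0 l 0))) + (f Eⁱ⁺¹ + + 0))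
  ≡⟨ regroup (f (term (+ 1) 0 0 0 1)) (sum₁ i (λ l → f (term (+ 1) 0 0 l 0))) (f Eⁱ⁺¹) ⟩
    f (term (+ 1) 0 0 0 1) + sum₁ (suc i) (λ l → f (term (+ 1) 0 0 l 0)) ∎
  where
  Eⁱ⁺¹ : Term
  Eⁱ⁺¹ = term (+ 1) 0 0 (suc i) 0

  q-terms : ∑ f (map (qmul ∘ Emul) (dE i)) ≡ + 0
  q-terms = trans (∑-map f (qmul ∘ Emul) (dE i))
                  (∑-zero (λ { (term c a b l j) → f-q⁺ c a b (suc l) j }) (dE i))

  regroup : ∀ a b c → + 0 + ((a + b) + (c + + 0)) ≡ a + (b + c)
  regroup = solve-∀

∑-mulX : ∀ (f : Term → ℤ) xs →
         ∑ f (mulX xs) ≡ ∑ (λ t → ∑ f (map ymul (Dmul t)) + f (Emul t)) xs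
∑-mulX f xs = begin
    ∑ f (concatMap (map ymul ∘ Dmul) xs ++ map Emul xs)
  ≡⟨ ∑-++ f (concatMap (map ymul ∘ Dmul) xs) _ ⟩
    ∑ f (concatMap (map ymul ∘ Dmul) xs) + ∑ f (map Emul xs)
  ≡⟨ cong₂ _+_ (∑-concatMap f (map ymul ∘ Dmul) xs) (∑-map f Emul xs) ⟩
    ∑ (λ t → ∑ f (map ymul (Dmul t))) xs + ∑ (f ∘ Emul) xs
  ≡⟨ sym (∑-+ (λ t → ∑ f (map ymul (Dmul t))) (f ∘ Emul) xs) ⟩
    ∑ (λ t → ∑ f (map ymul (Dmul t)) + f (Emul t)) xs ∎

module Specialisation (k : ℕ) where

  -- zCoeff n i m is the coefficient of yᵏ in yᵐ ⟨W| (yD + E)ⁿ Eⁱ |V⟩ at q = 0.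
  zCoeff : ℕ → ℕ → ℕ → ℤ
  zCoeff zero    i m = if m ℕ.+ i ≡ᵇ k then sgn i else + 0
  zCoeff (suc n) i m = zCoeff n (suc i) m + sum₀ i (λ l → zCoeff n l (suc m))

  -- What a normal-form term contributes to ZspecCoeff after a further multiplication by (yD + E)ⁿ.
  weight : ℕ → Term → ℤ
  weight n (term c a zero    i _) = c ℤ.* zCoeff n i a
  weight n (term _ _ (suc _) _ _) = + 0

  ∑-weight-yDmul : ∀ n c a i j →
    ∑ (weight n) (map ymul (Dmul (term c a 0 i j))) ≡ c ℤ.* sum₀ i (λ l → zCoeff n l (suc a))
  ∑-weight-yDmul n c a i j = begin
      ∑ (weight n) (map ymul (Dmul (term c a 0 i j)))
    ≡⟨ ∑-map (weight n) ymul (Dmul (term c a 0 i j)) ⟩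
      ∑ (weight n ∘ ymul) (map shift (dE i))
    ≡⟨ ∑-map (weight n ∘ ymul) shift (dE i) ⟩
      ∑ (weight n ∘ ymul ∘ shift) (dE i)
    ≡⟨ ∑-dE i (weight n ∘ ymul ∘ shift) (λ _ _ _ _ _ → refl) ⟩
      c′ ℤ.* zCoeff n 0 (suc (a ℕ.+ 0)) + sum₁ i (λ l → c′ ℤ.* zCoeff n l (suc (a ℕ.+ 0)))
    ≡⟨ cong (λ b → c′ ℤ.* zCoeff n 0 (suc b) + sum₁ i (λ l → c′ ℤ.* zCoeff n l (suc b)))
            (ℕ.+-identityʳ a) ⟩
      c′ ℤ.* zCoeff n 0 (suc a) + sum₁ i (λ l → c′ ℤ.* zCoeff n l (suc a))
    ≡⟨ cong (λ s → c′ ℤ.* zCoeff n 0 (suc a) + s) (sum₁-*ˡ i c′ (λ l → zCoeff n l (suc a))) ⟩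
      c′ ℤ.* zCoeff n 0 (suc a) + c′ ℤ.* sum₁ i (λ l → zCoeff n l (suc a))
    ≡⟨ sym (ℤ.*-distribˡ-+ c′ _ _) ⟩
      c′ ℤ.* sum₀ i (λ l → zCoeff n l (suc a))
    ≡⟨ cong (ℤ._* sum₀ i (λ l → zCoeff n l (suc a))) (ℤ.*-identityʳ c) ⟩
      c ℤ.* sum₀ i (λ l → zCoeff n l (suc a)) ∎
    where
    shift : Term → Term
    shift s = term (c ℤ.* coef s) (a ℕ.+ ye s) (0 ℕ.+ qe s) (ei s) (dj s ℕ.+ j)
    c′ : ℤ
    c′ = c ℤ.* + 1

  weight-step : ∀ n t → ∑ (weight n) (map ymul (Dmul t)) + weight n (Emul t) ≡ weight (suc n) t
  weight-step n (term c a zero i j) = begin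
      ∑ (weight n) (map ymul (Dmul (term c a 0 i j))) + c ℤ.* zCoeff n (suc i) a
    ≡⟨ cong (_+ c ℤ.* zCoeff n (suc i) a) (∑-weight-yDmul n c a i j) ⟩
      c ℤ.* sum₀ i (λ l → zCoeff n l (suc a)) + c ℤ.* zCoeff n (suc i) a
    ≡⟨ trans (ℤ.+-comm (c ℤ.* σ) _) (sym (ℤ.*-distribˡ-+ c (zCoeff n (suc i) a) σ)) ⟩
      c ℤ.* zCoeff (suc n) i a ∎
    where
    σ : ℤ
    σ = sum₀ i (λ l → zCoeff n l (suc a))
  weight-step n (term c a (suc b) i j) =
    cong (_+ + 0) (trans (∑-map (weight n) ymul (Dmul t)) (trans (∑-map (weight n ∘ ymul) shift (dE i))
                                                              (∑-zero (λ _ → refl) (dE i))))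
    where
    t : Term
    t = term c a (suc b) i j
    shift : Term → Term
    shift s = term (c ℤ.* coef s) (a ℕ.+ ye s) (suc b ℕ.+ qe s) (ei s) (dj s ℕ.+ j)

  ∑-weight-powX : ∀ N n → ∑ (weight n) (powX N) ≡ zCoeff (N ℕ.+ n) 0 0
  ∑-weight-powX zero    n = trans (ℤ.+-identityʳ _) (ℤ.*-identityˡ _)
  ∑-weight-powX (suc N) n = begin
      ∑ (weight n) (mulX (powX N))
    ≡⟨ trans (∑-mulX (weight n) (powX N)) (∑-cong (weight-step n) (powX N)) ⟩
      ∑ (weight (suc n)) (powX N)
    ≡⟨ ∑-weight-powX N (suc n) ⟩
      zCoeff (N ℕ.+ suc n) 0 0
    ≡⟨ cong (λ n′ → zCoeff n′ 0 0) (ℕ.+-suc N n) ⟩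
      zCoeff (suc N ℕ.+ n) 0 0 ∎

  ZspecCoeff≡zCoeff : ∀ N → ZspecCoeff N k ≡ zCoeff N 0 0
  ZspecCoeff≡zCoeff N = begin
      foldr specStep (+ 0) (powX N)
    ≡⟨ foldr-specStep (powX N) ⟩
      ∑ (weight 0) (powX N)
    ≡⟨ ∑-weight-powX N 0 ⟩
      zCoeff (N ℕ.+ 0) 0 0
    ≡⟨ cong (λ n → zCoeff n 0 0) (ℕ.+-identityʳ N) ⟩
      zCoeff N 0 0 ∎
    where
    specStep : Term → ℤ → ℤ
    specStep t s = if (qe t ≡ᵇ 0) ∧ ((ye t ℕ.+ ei t) ≡ᵇ k) then coef t ℤ.* sgn (ei t) + s else s

    foldr-specStep : ∀ xs → foldr specStep (+ 0) xs ≡ ∑ (weight 0) xs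
    foldr-specStep [] = refl
    foldr-specStep (term c a zero i j ∷ xs) with a ℕ.+ i ≡ᵇ k
    ... | true  = cong (λ s → c ℤ.* sgn i + s) (foldr-specStep xs)
    ... | false = trans (foldr-specStep xs)
                        (sym (trans (cong (_+ _) (ℤ.*-zeroʳ c)) (ℤ.+-identityˡ _)))
    foldr-specStep (term c a (suc b) i j ∷ xs) = trans (foldr-specStep xs) (sym (ℤ.+-identityˡ _))

-- G n i m plays the role of the coefficient of yᵏ in yᵐ ⟨W| (yD + E)ⁿ Eⁱ⁻¹ (E + y) |V⟩ for i ≥ 1,
-- and altSum recovers zCoeff from  G n (i + 1) m = zCoeff n (i + 1) m + zCoeff n i (m + 1).
module Inversion
  (k : ℕ) (G : ℕ → ℕ → ℕ → ℤ)
  (G-0-0     : ∀ m → G 0 0 m ≡ (if m ≡ᵇ k then + 1 else + 0))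
  (G-0-suc   : ∀ j m → G 0 (suc j) m ≡ + 0)
  (G-suc-0   : ∀ n m → G (suc n) 0 m ≡ G n 1 m)
  (G-suc-suc : ∀ n j m →
               G (suc n) (suc j) m ≡ G n (suc (suc j)) m + sum₀ (suc j) (λ l → G n l (suc m)))
  where

  open Specialisation k

  altSum : ℕ → ℕ → ℕ → ℤ
  altSum n zero    m = G n 0 m
  altSum n (suc i) m = G n (suc i) m - altSum n i (suc m)

  zCoeff₀≡altSum₀ : ∀ i m → zCoeff 0 i m ≡ altSum 0 i m
  zCoeff₀≡altSum₀ zero m rewrite ℕ.+-identityʳ m = sym (G-0-0 m)
  zCoeff₀≡altSum₀ (suc i) m
    rewrite ℕ.+-suc m i | G-0-suc i m | sym (zCoeff₀≡altSum₀ i (suc m)) with suc m ℕ.+ i ≡ᵇ k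
  ... | true  = sym (ℤ.+-identityˡ _)
  ... | false = refl

  sum₁-altSum : ∀ n i m → sum₁ (suc i) (λ l → altSum n l (suc m))
                        ≡ sum₁ (suc i) (λ l → G n l (suc m)) - sum₀ i (λ l → altSum n l (suc (suc m)))
  sum₁-altSum n i m = begin
      sum₁ (suc i) (λ l → altSum n l (suc m))
    ≡⟨ sum₁-suc i _ ⟩
      sum₀ i (λ l → G n (suc l) (suc m) - altSum n l (suc (suc m)))
    ≡⟨ sum₀-- i (λ l → G n (suc l) (suc m)) (λ l → altSum n l (suc (suc m))) ⟩
      sum₀ i (λ l → G n (suc l) (suc m)) - sum₀ i (λ l → altSum n l (suc (suc m)))
    ≡⟨ cong (_- sum₀ i (λ l → altSum n l (suc (suc m)))) (sym (sum₁-suc i (λ l → G n l (suc m)))) ⟩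
      sum₁ (suc i) (λ l → G n l (suc m)) - sum₀ i (λ l → altSum n l (suc (suc m))) ∎

  altSum-suc : ∀ n i m → altSum (suc n) i m ≡ altSum n (suc i) m + sum₀ i (λ l → altSum n l (suc m))
  altSum-suc n zero m = trans (G-suc-0 n m) (regroup _ _)
    where
    regroup : ∀ a b → a ≡ (a - b) + (b + + 0)
    regroup = solve-∀
  altSum-suc n (suc i) m = begin
      G (suc n) (suc i) m - altSum (suc n) i (suc m)
    ≡⟨ cong₂ _-_ (G-suc-suc n i m) (altSum-suc n i (suc m)) ⟩
      (G n (suc (suc i)) m + (G n 0 (suc m) + sum₁ (suc i) (λ l → G n l (suc m))))
        - (altSum n (suc i) (suc m) + sum₀ i (λ l → altSum n l (suc (suc m))))
    ≡⟨ regroup (G n (suc (suc i)) m) (G n 0 (suc m)) (sum₁ (suc i) (λ l → G n l (suc m)))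
               (altSum n (suc i) (suc m)) (sum₀ i (λ l → altSum n l (suc (suc m)))) ⟩
      (G n (suc (suc i)) m - altSum n (suc i) (suc m))
        + (G n 0 (suc m) + (sum₁ (suc i) (λ l → G n l (suc m)) - sum₀ i (λ l → altSum n l (suc (suc m)))))
    ≡⟨ cong (λ s → altSum n (suc (suc i)) m + (G n 0 (suc m) + s)) (sym (sum₁-altSum n i m)) ⟩
      altSum n (suc (suc i)) m + sum₀ (suc i) (λ l → altSum n l (suc m)) ∎
    where
    regroup : ∀ a b c d e → (a + (b + c)) - (d + e) ≡ (a - d) + (b + (c - e))
    regroup = solve-∀

  zCoeff≡altSum : ∀ n i m → zCoeff n i m ≡ altSum n i m
  zCoeff≡altSum zero    i m = zCoeff₀≡altSum₀ i m
  zCoeff≡altSum (suc n) i m = begin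
      zCoeff n (suc i) m + sum₀ i (λ l → zCoeff n l (suc m))
    ≡⟨ cong₂ _+_ (zCoeff≡altSum n (suc i) m) (sum₀-cong i (λ l → zCoeff≡altSum n l (suc m))) ⟩
      altSum n (suc i) m + sum₀ i (λ l → altSum n l (suc m))
    ≡⟨ sym (altSum-suc n i m) ⟩
      altSum (suc n) i m ∎

allPaths : ℕ → List (List Step)
allPaths zero    = [] ∷ []
allPaths (suc n) = map (U ∷_) (allPaths n) ++ map (D ∷_) (allPaths n)

∈-allPaths⁻ : ∀ n {P} → P ∈ allPaths n → length P ≡ n
∈-allPaths⁻ zero    (here refl) = refl
∈-allPaths⁻ (suc n) P∈ with ∈-++⁻ (map (U ∷_) (allPaths n)) P∈
... | inj₁ P∈U with ∈-map⁻ (U ∷_) P∈U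
...   | _ , Q∈ , refl = cong suc (∈-allPaths⁻ n Q∈)
∈-allPaths⁻ (suc n) P∈ | inj₂ P∈D with ∈-map⁻ (D ∷_) P∈D
...   | _ , Q∈ , refl = cong suc (∈-allPaths⁻ n Q∈)

∈-allPaths⁺ : ∀ P → P ∈ allPaths (length P)
∈-allPaths⁺ []      = here refl
∈-allPaths⁺ (U ∷ P) = ∈-++⁺ˡ (∈-map⁺ (U ∷_) (∈-allPaths⁺ P))
∈-allPaths⁺ (D ∷ P) = ∈-++⁺ʳ (map (U ∷_) (allPaths (length P))) (∈-map⁺ (D ∷_) (∈-allPaths⁺ P))

allPaths-unique : ∀ n → Unique (allPaths n)
allPaths-unique zero    = All.[] AllPairs.∷ AllPairs.[]
allPaths-unique (suc n) =
  Unique.++⁺ (Unique.map⁺ ∷-injectiveʳ (allPaths-unique n))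
             (Unique.map⁺ ∷-injectiveʳ (allPaths-unique n))
             disjoint
  where
  disjoint : ∀ {P} → ¬ (P ∈ map (U ∷_) (allPaths n) × P ∈ map (D ∷_) (allPaths n))
  disjoint (P∈U , P∈D) with ∈-map⁻ (U ∷_) P∈U | ∈-map⁻ (D ∷_) P∈D
  ... | _ , _ , refl | _ , _ , ()

count-allPaths-suc : ∀ (p : List Step → Bool) n →
  count p (allPaths (suc n)) ≡ count (p ∘ (U ∷_)) (allPaths n) + count (p ∘ (D ∷_)) (allPaths n)
count-allPaths-suc p n =
  trans (∑-++ indicator (map (U ∷_) (allPaths n)) _)
        (cong₂ _+_ (∑-map indicator (U ∷_) (allPaths n)) (∑-map indicator (D ∷_) (allPaths n)))
  where
  indicator : List Step → ℤ
  indicator P = if p P then + 1 else + 0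

-- A hill is a peak at height 1.
hillFree : ℕ → List Step → Bool
hillFree h       []          = true
hillFree zero    (U ∷ D ∷ _) = false
hillFree h       (U ∷ P)     = hillFree (suc h) P
hillFree zero    (D ∷ _)     = true
hillFree (suc h) (D ∷ P)     = hillFree h P

Hill : ℕ → List Step → Set
Hill h P = Σ (List Step) λ Q → Σ (List Step) λ P₂ → ValidFrom h Q × Dyck P₂ × P ≡ Q ++ U ∷ D ∷ P₂

¬hillFree-++-peak : ∀ h Q P₂ → ValidFrom h Q → ¬ T (hillFree h (Q ++ U ∷ D ∷ P₂))
¬hillFree-++-peak zero    []          P₂ refl = λ ()
¬hillFree-++-peak zero    (U ∷ [])    P₂ ()
¬hillFree-++-peak zero    (U ∷ D ∷ Q) P₂ v    = λ ()
¬hillFree-++-peak zero    (U ∷ U ∷ Q) P₂ v    = ¬hillFree-++-peak 1 (U ∷ Q) P₂ v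
¬hillFree-++-peak zero    (D ∷ Q)     P₂ ()
¬hillFree-++-peak (suc h) []          P₂ ()
¬hillFree-++-peak (suc h) (U ∷ Q)     P₂ v    = ¬hillFree-++-peak (suc (suc h)) Q P₂ v
¬hillFree-++-peak (suc h) (D ∷ Q)     P₂ v    = ¬hillFree-++-peak h Q P₂ v

¬hillFree⇒Hill : ∀ h P → ValidFrom h P → ¬ T (hillFree h P) → Hill h P
¬hillFree⇒Hill h       []          v ¬t = ⊥-elim (¬t _)
¬hillFree⇒Hill zero    (U ∷ [])    () ¬t
¬hillFree⇒Hill zero    (U ∷ D ∷ P) v ¬t = [] , P , refl , v , refl
¬hillFree⇒Hill zero    (U ∷ U ∷ P) v ¬t with ¬hillFree⇒Hill 1 (U ∷ P) v ¬t
... | Q , P₂ , vQ , d , eq = U ∷ Q , P₂ , vQ , d , cong (U ∷_) eq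
¬hillFree⇒Hill zero    (D ∷ P)     () ¬t
¬hillFree⇒Hill (suc h) (U ∷ P)     v ¬t with ¬hillFree⇒Hill (suc (suc h)) P v ¬t
... | Q , P₂ , vQ , d , eq = U ∷ Q , P₂ , vQ , d , cong (U ∷_) eq
¬hillFree⇒Hill (suc h) (D ∷ P)     v ¬t with ¬hillFree⇒Hill h P v ¬t
... | Q , P₂ , vQ , d , eq = D ∷ Q , P₂ , vQ , d , cong (D ∷_) eq

m+2*[1+n]≡2+[m+2*n] : ∀ m n → m ℕ.+ 2 * suc n ≡ suc (suc (m ℕ.+ 2 * n))
m+2*[1+n]≡2+[m+2*n] m n =
  trans (cong (m ℕ.+_) (ℕ.*-suc 2 n)) (trans (ℕ.+-suc m _) (cong suc (ℕ.+-suc m _)))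

-- Counting hill-free paths by peaks

module HillFreePaths (k : ℕ) where

  -- accepts h u m P: P is read from height h, u records that the previous step was ↗ and
  -- m peaks have been seen; P must return to 0, avoid hills, and bring the peak count to k.
  accepts : ℕ → Bool → ℕ → List Step → Bool
  accepts h             _     m []      = (h ≡ᵇ 0) ∧ (m ≡ᵇ k)
  accepts h             _     m (U ∷ P) = accepts (suc h) true m P
  accepts zero          _     m (D ∷ P) = false
  accepts (suc h)       false m (D ∷ P) = accepts h false m P
  accepts (suc zero)    true  m (D ∷ P) = false
  accepts (suc (suc h)) true  m (D ∷ P) = accepts (suc h) false (suc m) P

  accepts-sound : ∀ h m P → T (accepts h false m P) →
                  ValidFrom h P × T (hillFree h P) × m ℕ.+ pk P ≡ k
  accepts-sound zero    m []          t = refl , _ , trans (ℕ.+-identityʳ m) (ℕ.≡ᵇ⇒≡ m k t)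
  accepts-sound (suc h) m []          ()
  accepts-sound h       m (U ∷ [])    ()
  accepts-sound zero    m (U ∷ U ∷ P) t = accepts-sound 1 m (U ∷ P) t
  accepts-sound (suc h) m (U ∷ U ∷ P) t = accepts-sound (suc (suc h)) m (U ∷ P) t
  accepts-sound zero    m (U ∷ D ∷ P) ()
  accepts-sound (suc h) m (U ∷ D ∷ P) t with accepts-sound (suc h) (suc m) P t
  ... | v , f , e = v , f , trans (ℕ.+-suc m (pk P)) e
  accepts-sound zero    m (D ∷ P)     ()
  accepts-sound (suc h) m (D ∷ P)     t = accepts-sound h m P t

  accepts-complete : ∀ h m P → ValidFrom h P → T (hillFree h P) → m ℕ.+ pk P ≡ k →
                     T (accepts h false m P)
  accepts-complete zero    m []          v f e = ℕ.≡⇒≡ᵇ m k (trans (sym (ℕ.+-identityʳ m)) e)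
  accepts-complete h       m (U ∷ [])    () f e
  accepts-complete zero    m (U ∷ U ∷ P) v f e = accepts-complete 1 m (U ∷ P) v f e
  accepts-complete (suc h) m (U ∷ U ∷ P) v f e = accepts-complete (suc (suc h)) m (U ∷ P) v f e
  accepts-complete zero    m (U ∷ D ∷ P) v () e
  accepts-complete (suc h) m (U ∷ D ∷ P) v f e =
    accepts-complete (suc h) (suc m) P v f (trans (sym (ℕ.+-suc m (pk P))) e)
  accepts-complete (suc h) m (D ∷ P)     v f e = accepts-complete h m P v f e

  accepts⇔Fine : ∀ P → T (accepts 0 false 0 P) ⇔ (Fine P × pk P ≡ k)
  accepts⇔Fine P = mk⇔ to from
    where
    to : T (accepts 0 false 0 P) → Fine P × pk P ≡ k
    to t with accepts-sound 0 0 P t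
    ... | d , f , e = (d , λ { (Q , P₂ , vQ , _ , refl) → ¬hillFree-++-peak 0 Q P₂ vQ f }) , e

    from : Fine P × pk P ≡ k → T (accepts 0 false 0 P)
    from ((d , ¬hill) , e) with T? (hillFree 0 P)
    ... | yes f  = accepts-complete 0 0 P d f e
    ... | no ¬f = ⊥-elim (¬hill (¬hillFree⇒Hill 0 P d ¬f))

  count-accepts-short : ∀ l h u m → l < h → count (accepts h u m) (allPaths l) ≡ + 0
  count-accepts-short zero    (suc h) u m _         = refl
  count-accepts-short (suc l) (suc h) u m (s≤s l<h) = begin
      count (accepts (suc h) u m) (allPaths (suc l))
    ≡⟨ count-allPaths-suc (accepts (suc h) u m) l ⟩
      count (accepts (suc (suc h)) true m) (allPaths l) + count (λ P → accepts (suc h) u m (D ∷ P)) (allPaths l)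
    ≡⟨ cong₂ _+_ (count-accepts-short l (suc (suc h)) true m (ℕ.m<n⇒m<1+n (ℕ.m<n⇒m<1+n l<h)))
                 (after-D h u l<h) ⟩
      + 0 ∎
    where
    after-D : ∀ h u → l < h → count (λ P → accepts (suc h) u m (D ∷ P)) (allPaths l) ≡ + 0
    after-D (suc h) false l<h = count-accepts-short l (suc h) false m l<h
    after-D (suc h) true  l<h = count-accepts-short l (suc h) false (suc m) l<h

  -- Accepted paths of length j + 2n from height j whose first step is ↗ (for j = 0: all of them).
  countUp : ℕ → ℕ → ℕ → ℤ
  countUp n zero    m = count (accepts 0 false m) (allPaths (2 * n))
  countUp n (suc j) m = count (accepts (suc (suc j)) true m) (allPaths (j ℕ.+ 2 * n))

  countAll : ℕ → ℕ → ℕ → ℤ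
  countAll n j m = count (accepts j false m) (allPaths (j ℕ.+ 2 * n))

  countAll≡sum₀ : ∀ n j m → countAll n j m ≡ sum₀ j (λ l → countUp n l m)
  countAll≡sum₀ n zero    m = sym (ℤ.+-identityʳ _)
  countAll≡sum₀ n (suc j) m = begin
      countAll n (suc j) m
    ≡⟨ count-allPaths-suc (accepts (suc j) false m) (j ℕ.+ 2 * n) ⟩
      countUp n (suc j) m + countAll n j m
    ≡⟨ cong (λ s → countUp n (suc j) m + s) (countAll≡sum₀ n j m) ⟩
      countUp n (suc j) m + (countUp n 0 m + sum₁ j (λ l → countUp n l m))
    ≡⟨ regroup (countUp n (suc j) m) (countUp n 0 m) (sum₁ j (λ l → countUp n l m)) ⟩
      sum₀ (suc j) (λ l → countUp n l m) ∎
    where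
    regroup : ∀ a b c → a + (b + c) ≡ b + (c + a)
    regroup = solve-∀

  countUp-0-0 : ∀ m → countUp 0 0 m ≡ (if m ≡ᵇ k then + 1 else + 0)
  countUp-0-0 m = ℤ.+-identityʳ _

  countUp-0-suc : ∀ j m → countUp 0 (suc j) m ≡ + 0
  countUp-0-suc j m = count-accepts-short (j ℕ.+ 0) (suc (suc j)) true m
    (s≤s (ℕ.m≤n⇒m≤1+n (ℕ.≤-reflexive (ℕ.+-identityʳ j))))

  countUp-suc-0 : ∀ n m → countUp (suc n) 0 m ≡ countUp n 1 m
  countUp-suc-0 n m = begin
      count (accepts 0 false m) (allPaths (2 * suc n))
    ≡⟨ cong (count (accepts 0 false m) ∘ allPaths) (m+2*[1+n]≡2+[m+2*n] 0 n) ⟩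
      count (accepts 0 false m) (allPaths (suc (suc (2 * n))))
    ≡⟨ count-allPaths-suc (accepts 0 false m) (suc (2 * n)) ⟩
      count (accepts 1 true m) (allPaths (suc (2 * n))) + count (λ _ → false) (allPaths (suc (2 * n)))
    ≡⟨ cong₂ _+_ (count-allPaths-suc (accepts 1 true m) (2 * n)) (count-false (allPaths (suc (2 * n)))) ⟩
      (countUp n 1 m + count (λ _ → false) (allPaths (2 * n))) + + 0
    ≡⟨ ℤ.+-identityʳ _ ⟩
      countUp n 1 m + count (λ _ → false) (allPaths (2 * n))
    ≡⟨ trans (cong (λ s → countUp n 1 m + s) (count-false (allPaths (2 * n)))) (ℤ.+-identityʳ _) ⟩
      countUp n 1 m ∎

  countUp-suc-suc : ∀ n j m →
    countUp (suc n) (suc j) m ≡ countUp n (suc (suc j)) m + sum₀ (suc j) (λ l → countUp n l (suc m))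
  countUp-suc-suc n j m = begin
      count (accepts (suc (suc j)) true m) (allPaths (j ℕ.+ 2 * suc n))
    ≡⟨ cong (count (accepts (suc (suc j)) true m) ∘ allPaths) (m+2*[1+n]≡2+[m+2*n] j n) ⟩
      count (accepts (suc (suc j)) true m) (allPaths (suc (suc (j ℕ.+ 2 * n))))
    ≡⟨ count-allPaths-suc (accepts (suc (suc j)) true m) (suc (j ℕ.+ 2 * n)) ⟩
      countUp n (suc (suc j)) m + countAll n (suc j) (suc m)
    ≡⟨ cong (λ s → countUp n (suc (suc j)) m + s) (countAll≡sum₀ n (suc j) (suc m)) ⟩
      countUp n (suc (suc j)) m + sum₀ (suc j) (λ l → countUp n l (suc m)) ∎

  finePaths : ℕ → List (List Step)
  finePaths n = filter (T? ∘ accepts 0 false 0) (allPaths n)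

  finePaths-unique : ∀ n → Unique (finePaths n)
  finePaths-unique n = Unique.filter⁺ (T? ∘ accepts 0 false 0) (allPaths-unique n)

  ∈-finePaths⇔ : ∀ n P → P ∈ finePaths n ⇔ (Fine P × length P ≡ n × pk P ≡ k)
  ∈-finePaths⇔ n P = mk⇔ to from
    where
    to : P ∈ finePaths n → Fine P × length P ≡ n × pk P ≡ k
    to P∈ with ∈-filter⁻ (T? ∘ accepts 0 false 0) P∈
    ... | P∈all , t with Equivalence.to (accepts⇔Fine P) t
    ...   | fine , e = fine , ∈-allPaths⁻ n P∈all , e

    from : Fine P × length P ≡ n × pk P ≡ k → P ∈ finePaths n
    from (fine , refl , e) =
      ∈-filter⁺ (T? ∘ accepts 0 false 0) (∈-allPaths⁺ P) (Equivalence.from (accepts⇔Fine P) (fine , e))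

proposition7p2 : (N : ℕ) → 1 ≤ N → (k : ℕ) →
    Σ (List (List Step)) λ L →
      Unique L ×
      ((∀ P → (P ∈ L) ⇔ (Fine P × length P ≡ 2 * N × pk P ≡ k)) ×
       ZspecCoeff N k ≡ + (length L))
proposition7p2 N _ k =
  finePaths (2 * N) , finePaths-unique (2 * N) , ∈-finePaths⇔ (2 * N) , ZspecCoeff≡length
  where
  open HillFreePaths k
  open Specialisation k
  open Inversion k countUp countUp-0-0 countUp-0-suc countUp-suc-0 countUp-suc-suc

  ZspecCoeff≡length : ZspecCoeff N k ≡ + length (finePaths (2 * N))
  ZspecCoeff≡length = begin
      ZspecCoeff N k
    ≡⟨ ZspecCoeff≡zCoeff N ⟩
      zCoeff N 0 0
    ≡⟨ zCoeff≡altSum N 0 0 ⟩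
      count (accepts 0 false 0) (allPaths (2 * N))
    ≡⟨ sym (length-filter (accepts 0 false 0) (allPaths (2 * N))) ⟩
      + length (finePaths (2 * N)) ∎
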